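{- Let $k$, $l$, $d$ be positive integers with $k>l$, and let $\delta=\gcd(d,k-l)$. Then for a positive integer $m$, $\mathbb{Z}_d$ contains a $(k,l)$-sum-free interval of size $m$ if and only if \[ k(m-1)+\left\lceil \frac{l(m-1)+1}{\delta}\right\rceil\cdot\delta \;<\; d. \]
   Context: An interval in $\mathbb{Z}_d$ is a set $[a,a+m-1]=\{a,a+1,\dots,a+m-1\}$ with $a\in\mathbb{Z}_d$, having exactly $m$ elements. For a subset $A$ and positive integer $h$, $hA$ denotes the $h$-fold sumset $\{a_1+\cdots+a_h: a_i\in A\}$; $A$ is $(k,l)$-sum-free if $kA\cap lA=\emptyset$, equivalently $0\notin kA-lA$. -}

module Defs where

open import Data.Nat using (ℕ; zero; suc; _+_; _*_; _∸_; _<_; _≤_; _/_; _%_; NonZero)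
open import Data.Nat.GCD using (gcd)
open import Data.Fin using (Fin)
open import Data.Product using (Σ; _×_; ∃)
open import Relation.Binary.PropositionalEquality using (_≡_)
open import Relation.Nullary using (¬_)

sumFin : (h : ℕ) → (Fin h → ℕ) → ℕ
sumFin zero    f = 0
sumFin (suc h) f = f Fin.zero + sumFin h (λ j → f (Fin.suc j))

-- the interval [a, a+m-1] in Z_d has elements (a + i) mod d, i < m.
-- x ∈ h·[a,a+m-1] in Z_d  iff  x ≡ (Σ_{j<h} (a + f j)) mod d for some f : Fin h → Fin m
InSumset : (d : ℕ) .{{_ : NonZero d}} → (a m h : ℕ) → ℕ → Set
InSumset d a m h x = Σ (Fin h → Fin m) λ f → sumFin h (λ j → a + Data.Fin.toℕ (f j)) % d ≡ x

SumFreeInterval : (d : ℕ) .{{_ : NonZero d}} → (k l a m : ℕ) → Set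
SumFreeInterval d k l a m = ∀ x → InSumset d a m k x → ¬ InSumset d a m l x

-- Z_d contains a (k,l)-sum-free interval of size m:
-- some a ∈ Z_d (a < d) such that [a,a+m-1] has exactly m elements (m ≤ d) and is sum-free
HasSumFreeInterval : (d : ℕ) .{{_ : NonZero d}} → (k l m : ℕ) → Set
HasSumFreeInterval d k l m = m ≤ d × Σ ℕ λ a → a < d × SumFreeInterval d k l a m

-- ceiling division ⌈x / δ⌉ for δ ≥ 1 (value at δ = 0 irrelevant)
ceilDiv : ℕ → ℕ → ℕ
ceilDiv x zero    = 0
ceilDiv x (suc n) = (x + n) / suc n

{-# OPTIONS --safe #-}
-- Write k = l + c and A = [a, a + M].  The h-fold sums of A are h·a + s with 0 ≤ s ≤ h·M, so
-- kA and lA meet iff v + s ≡ t (mod d) for some s ≤ k·M, t ≤ l·M, where v = c·a mod d.  As v < d,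
-- this fails exactly when l·M < v and k·M + v < d.  By Bézout the residues c·a mod d are precisely
-- the multiples of δ = gcd(d, c) below d, and the least multiple of δ exceeding l·M is
-- ⌈(l·M + 1)/δ⌉·δ.
module Submission where

open import Defs
open import Data.Nat using (ℕ; zero; suc; _+_; _*_; _∸_; _<_; _>_; _≤_; NonZero; z≤n; s≤s; pred; _≤?_; _<?_; ≢-nonZero; ≢-nonZero⁻¹; >-nonZero; >-nonZero⁻¹)
open import Data.Nat.Properties
open import Algebra.Properties.CommutativeSemigroup *-commutativeSemigroup using (x∙yz≈y∙xz)
open import Data.Nat.DivMod
open import Data.Nat.Divisibility using (_∣_; divides-refl; n∣m*n; ∣m⇒∣m*n; %-presˡ-∣)
open import Data.Nat.GCD using (gcd; gcd[m,n]∣m; gcd[m,n]∣n; gcd[m,n]≢0; gcd-GCD; module Bézout)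
open import Data.Fin using (Fin; toℕ; fromℕ<; zero; suc)
open import Data.Fin.Properties using (toℕ<n; toℕ-fromℕ<)
open import Data.Product using (Σ; ∃; _×_; _,_)
open import Data.Sum using (inj₁)
open import Data.Empty using (⊥-elim)
open import Relation.Nullary using (¬_; yes; no)
open import Relation.Binary.PropositionalEquality
open import Function.Bundles using (_⇔_; mk⇔; Equivalence)
open import Data.Nat.Solver using (module +-*-Solver)
open +-*-Solver

sumFin-shift : ∀ h a (g : Fin h → ℕ) → sumFin h (λ j → a + g j) ≡ h * a + sumFin h g
sumFin-shift zero    a g = refl
sumFin-shift (suc h) a g rewrite sumFin-shift h a (λ j → g (suc j)) =
  solve 4 (λ a x y z → (a :+ x) :+ (y :+ z) := (a :+ y) :+ (x :+ z)) refl
    a (g zero) (h * a) (sumFin h (λ j → g (suc j)))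

sumFin-toℕ≤ : ∀ h M (f : Fin h → Fin (suc M)) → sumFin h (λ j → toℕ (f j)) ≤ h * M
sumFin-toℕ≤ zero    M f = z≤n
sumFin-toℕ≤ (suc h) M f = +-mono-≤ (≤-pred (toℕ<n (f zero))) (sumFin-toℕ≤ h M (λ j → f (suc j)))

sumFin-toℕ-onto : ∀ h M s → s ≤ h * M → Σ (Fin h → Fin (suc M)) λ f → sumFin h (λ j → toℕ (f j)) ≡ s
sumFin-toℕ-onto zero    M s s≤0 = (λ ()) , sym (n≤0⇒n≡0 s≤0)
sumFin-toℕ-onto (suc h) M s s≤hM with s ≤? M
... | yes s≤M with f , Σf≡0 ← sumFin-toℕ-onto h M 0 z≤n =
  (λ { zero → fromℕ< (s≤s s≤M) ; (suc j) → f j }) ,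
  trans (cong₂ _+_ (toℕ-fromℕ< (s≤s s≤M)) Σf≡0) (+-identityʳ s)
... | no s≰M with f , Σf≡s∸M ← sumFin-toℕ-onto h M (s ∸ M) (m≤n+o⇒m∸n≤o s M s≤hM) =
  (λ { zero → fromℕ< (n<1+n M) ; (suc j) → f j }) ,
  trans (cong₂ _+_ (toℕ-fromℕ< (n<1+n M)) Σf≡s∸M) (m+[n∸m]≡n (<⇒≤ (≰⇒> s≰M)))

m≤ceilDiv[m,n]*n : ∀ m n .{{_ : NonZero n}} → m ≤ ceilDiv m n * n
m≤ceilDiv[m,n]*n m (suc n) = +-cancelʳ-≤ n m _ (begin
  m + n                      ≡⟨ m≡m%n+[m/n]*n (m + n) (suc n) ⟩
  (m + n) % suc n + q * suc n ≤⟨ +-monoˡ-≤ (q * suc n) (≤-pred (m%n<n (m + n) (suc n))) ⟩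
  n + q * suc n              ≡⟨ +-comm n _ ⟩
  q * suc n + n              ∎)
  where
  open ≤-Reasoning
  q = (m + n) / suc n

m≤o*n⇒ceilDiv[m,n]≤o : ∀ m n o .{{_ : NonZero n}} → m ≤ o * n → ceilDiv m n ≤ o
m≤o*n⇒ceilDiv[m,n]≤o m (suc n) o m≤on = ≤-pred (m<n*o⇒m/o<n (begin-strict
  m + n            ≤⟨ +-monoˡ-≤ n m≤on ⟩
  o * suc n + n    <⟨ +-monoʳ-< (o * suc n) (n<1+n n) ⟩
  o * suc n + suc n ≡⟨ +-comm (o * suc n) (suc n) ⟩
  suc o * suc n    ∎))
  where open ≤-Reasoning

module _ (d : ℕ) .{{_ : NonZero d}} where

  %-cong-+ˡ : ∀ w {x y} → x % d ≡ y % d → (w + x) % d ≡ (w + y) % d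
  %-cong-+ˡ w {x} {y} eq = begin
    (w + x) % d             ≡⟨ %-distribˡ-+ w x d ⟩
    (w % d + x % d) % d     ≡⟨ cong (λ z → (w % d + z) % d) eq ⟩
    (w % d + y % d) % d     ≡⟨ %-distribˡ-+ w y d ⟨
    (w + y) % d             ∎
    where open ≡-Reasoning

  %-cong-+ʳ : ∀ w {x y} → x % d ≡ y % d → (x + w) % d ≡ (y + w) % d
  %-cong-+ʳ w {x} {y} eq = begin
    (x + w) % d ≡⟨ cong (_% d) (+-comm x w) ⟩
    (w + x) % d ≡⟨ %-cong-+ˡ w eq ⟩
    (w + y) % d ≡⟨ cong (_% d) (+-comm w y) ⟩
    (y + w) % d ∎
    where open ≡-Reasoning

  %-cong-*ˡ : ∀ w {x y} → x % d ≡ y % d → (w * x) % d ≡ (w * y) % d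
  %-cong-*ˡ w {x} {y} eq = begin
    (w * x) % d             ≡⟨ %-distribˡ-* w x d ⟩
    (w % d * (x % d)) % d   ≡⟨ cong (λ z → (w % d * z) % d) eq ⟩
    (w % d * (y % d)) % d   ≡⟨ %-distribˡ-* w y d ⟨
    (w * y) % d             ∎
    where open ≡-Reasoning

  %-cancel-+ˡ : ∀ w {x y} → (w + x) % d ≡ (w + y) % d → x % d ≡ y % d
  %-cancel-+ˡ w {x} {y} eq = begin
    x % d                      ≡⟨ negate-w x ⟨
    (w * pred d + (w + x)) % d ≡⟨ %-cong-+ˡ (w * pred d) eq ⟩
    (w * pred d + (w + y)) % d ≡⟨ negate-w y ⟩
    y % d                      ∎
    where
    open ≡-Reasoning
    -- w * pred d acts as the additive inverse of w modulo d
    negate-w : ∀ z → (w * pred d + (w + z)) % d ≡ z % d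
    negate-w z = begin
      (w * pred d + (w + z)) % d ≡⟨ cong (_% d) (+-assoc (w * pred d) w z) ⟨
      (w * pred d + w + z) % d   ≡⟨ cong (λ t → (t + z) % d) (+-comm (w * pred d) w) ⟩
      (w + w * pred d + z) % d   ≡⟨ cong (λ t → (t + z) % d) (*-suc w (pred d)) ⟨
      (w * suc (pred d) + z) % d ≡⟨ cong (λ t → (w * t + z) % d) (suc-pred d) ⟩
      (w * d + z) % d            ≡⟨ %-remove-+ˡ z (n∣m*n w) ⟩
      z % d                      ∎

  gcd∣[m*n]%d : ∀ c a → gcd d c ∣ (c * a) % d
  gcd∣[m*n]%d c a = %-presˡ-∣ (∣m⇒∣m*n a (gcd[m,n]∣n d c)) (gcd[m,n]∣m d c)

  gcd-residue : ∀ c → ∃ λ a → (c * a) % d ≡ gcd d c % d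
  gcd-residue c with Bézout.identity (gcd-GCD d c)
  ... | Bézout.-+ x y eq = y , (begin
    (c * y) % d     ≡⟨ cong (_% d) (trans (*-comm c y) (sym eq)) ⟩
    (δ + x * d) % d ≡⟨ [m+kn]%n≡m%n δ x d ⟩
    δ % d           ∎)
    where
    open ≡-Reasoning
    δ = gcd d c
  ... | Bézout.+- x y eq = y * pred d , %-cancel-+ˡ (y * c) (begin
    (y * c + c * (y * pred d)) % d ≡⟨ cong (_% d) ycd-expand ⟩
    (y * c * d) % d                ≡⟨ m*n%n≡0 (y * c) d ⟩
    0                              ≡⟨ m*n%n≡0 x d ⟨
    (x * d) % d                    ≡⟨ cong (_% d) (trans (sym eq) (+-comm δ (y * c))) ⟩
    (y * c + δ) % d                ∎)
    where
    open ≡-Reasoning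
    δ = gcd d c
    ycd-expand : y * c + c * (y * pred d) ≡ y * c * d
    ycd-expand = begin
      y * c + c * (y * pred d)   ≡⟨ solve 3 (λ y c p → y :* c :+ c :* (y :* p) := y :* c :* (con 1 :+ p)) refl y c (pred d) ⟩
      y * c * suc (pred d)       ≡⟨ cong (y * c *_) (suc-pred d) ⟩
      y * c * d                  ∎

  gcd-multiple-residue : ∀ c j → ∃ λ a → a < d × (c * a) % d ≡ (j * gcd d c) % d
  gcd-multiple-residue c j with a₀ , ca₀≡δ ← gcd-residue c = (j * a₀) % d , m%n<n (j * a₀) d , (begin
    (c * ((j * a₀) % d)) % d ≡⟨ %-cong-*ˡ c (m%n%n≡m%n (j * a₀) d) ⟩
    (c * (j * a₀)) % d       ≡⟨ cong (_% d) (x∙yz≈y∙xz c j a₀) ⟩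
    (j * (c * a₀)) % d       ≡⟨ %-cong-*ˡ j ca₀≡δ ⟩
    (j * gcd d c) % d        ∎)
    where open ≡-Reasoning

  inSumset⇔ : ∀ a M h x → InSumset d a (suc M) h x ⇔ ∃ λ s → s ≤ h * M × (h * a + s) % d ≡ x
  inSumset⇔ a M h x = mk⇔
    (λ (f , Σ≡x) → sumFin h (λ j → toℕ (f j)) , sumFin-toℕ≤ h M f ,
      trans (cong (_% d) (sym (sumFin-shift h a _))) Σ≡x)
    (λ (s , s≤hM , eq) → let f , Σf≡s = sumFin-toℕ-onto h M s s≤hM in
      f , trans (cong (_% d) (trans (sumFin-shift h a _) (cong (h * a +_) Σf≡s))) eq)

  module _ (l c M a : ℕ) where

    private
      K = (l + c) * M
      L = l * M
      v = (c * a) % d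

    kA∩lA⇔ : ∀ s t → ((l + c) * a + s) % d ≡ (l * a + t) % d ⇔ (v + s) % d ≡ t % d
    kA∩lA⇔ s t = mk⇔
      (λ eq → trans (sym ca+s≡v+s) (%-cancel-+ˡ (l * a) (trans (cong (_% d) (sym split)) eq)))
      (λ eq → trans (cong (_% d) split) (%-cong-+ˡ (l * a) (trans ca+s≡v+s eq)))
      where
      split : (l + c) * a + s ≡ l * a + (c * a + s)
      split = trans (cong (_+ s) (*-distribʳ-+ a l c)) (+-assoc (l * a) (c * a) s)
      ca+s≡v+s : (c * a + s) % d ≡ (v + s) % d
      ca+s≡v+s = %-cong-+ʳ s (sym (m%n%n≡m%n (c * a) d))

    collision⇒¬sumFree : ∀ s t → s ≤ K → t ≤ L → (v + s) % d ≡ t % d → ¬ SumFreeInterval d (l + c) l a (suc M)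
    collision⇒¬sumFree s t s≤K t≤L eq sumFree = sumFree x
      (Equivalence.from (inSumset⇔ a M (l + c) x) (s , s≤K , refl))
      (Equivalence.from (inSumset⇔ a M l x) (t , t≤L , sym (Equivalence.from (kA∩lA⇔ s t) eq)))
      where x = ((l + c) * a + s) % d

    sumFree⇔ : SumFreeInterval d (l + c) l a (suc M) ⇔ (L < v × K + v < d)
    sumFree⇔ = mk⇔ necessary sufficient
      where
      v<d : v < d
      v<d = m%n<n (c * a) d

      necessary : SumFreeInterval d (l + c) l a (suc M) → L < v × K + v < d
      necessary sumFree with v ≤? L
      ... | yes v≤L = ⊥-elim (collision⇒¬sumFree 0 v z≤n v≤L (cong (_% d) (+-identityʳ v)) sumFree)
      ... | no v≰L with K + v <? d
      ...   | yes K+v<d = ≰⇒> v≰L , K+v<d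
      ...   | no K+v≮d = ⊥-elim (collision⇒¬sumFree (d ∸ v) 0 d∸v≤K z≤n v+[d∸v]≡0 sumFree)
        where
        d∸v≤K : d ∸ v ≤ K
        d∸v≤K = m≤n+o⇒m∸n≤o d v (subst (d ≤_) (+-comm K v) (≮⇒≥ K+v≮d))
        v+[d∸v]≡0 : (v + (d ∸ v)) % d ≡ 0 % d
        v+[d∸v]≡0 = begin
          (v + (d ∸ v)) % d ≡⟨ cong (_% d) (m+[n∸m]≡n (<⇒≤ v<d)) ⟩
          d % d             ≡⟨ n%n≡0 d ⟩
          0                 ≡⟨ m<n⇒m%n≡m (>-nonZero⁻¹ d) ⟨
          0 % d             ∎
          where open ≡-Reasoning

      -- both sides are reduced residues, so a collision is an equality v + s = t ≤ L < v
      sufficient : L < v × K + v < d → SumFreeInterval d (l + c) l a (suc M)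
      sufficient (L<v , K+v<d) x x∈kA x∈lA
        with s , s≤K , eqs ← Equivalence.to (inSumset⇔ a M (l + c) x) x∈kA
           | t , t≤L , eqt ← Equivalence.to (inSumset⇔ a M l x) x∈lA
        = <-irrefl refl (≤-<-trans t≤L (<-≤-trans L<v (subst (v ≤_) v+s≡t (m≤m+n v s))))
        where
        v+s<d : v + s < d
        v+s<d = ≤-<-trans (+-monoʳ-≤ v s≤K) (subst (_< d) (+-comm K v) K+v<d)
        t<d : t < d
        t<d = ≤-<-trans t≤L (<-trans L<v v<d)
        v+s≡t : v + s ≡ t
        v+s≡t = begin
          v + s       ≡⟨ m<n⇒m%n≡m v+s<d ⟨
          (v + s) % d ≡⟨ Equivalence.to (kA∩lA⇔ s t) (trans eqs (sym eqt)) ⟩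
          t % d       ≡⟨ m<n⇒m%n≡m t<d ⟩
          t           ∎
          where open ≡-Reasoning

  hasSumFreeInterval⇔ : ∀ l c M → 0 < l + c →
    HasSumFreeInterval d (l + c) l (suc M) ⇔ (l + c) * M + ceilDiv (l * M + 1) (gcd d c) * gcd d c < d
  hasSumFreeInterval⇔ l c M 0<k = mk⇔ necessary sufficient
    where
    instance
      δ≢0 : NonZero (gcd d c)
      δ≢0 = ≢-nonZero (gcd[m,n]≢0 d c (inj₁ (≢-nonZero⁻¹ d)))
      k≢0 : NonZero (l + c)
      k≢0 = >-nonZero 0<k
    δ = gcd d c
    K = (l + c) * M
    L = l * M
    q = ceilDiv (L + 1) δ
    u = q * δ

    L<u : L < u
    L<u = subst (_≤ u) (+-comm L 1) (m≤ceilDiv[m,n]*n (L + 1) δ)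

    u-least : ∀ v → δ ∣ v → L < v → u ≤ v
    u-least .(j * δ) (divides-refl j) L<jδ =
      *-monoˡ-≤ δ (m≤o*n⇒ceilDiv[m,n]≤o (L + 1) δ j (subst (_≤ j * δ) (+-comm 1 L) L<jδ))

    necessary : HasSumFreeInterval d (l + c) l (suc M) → K + u < d
    necessary (_ , a , _ , sumFree) =
      let L<v , K+v<d = Equivalence.to (sumFree⇔ l c M a) sumFree
      in ≤-<-trans (+-monoʳ-≤ K (u-least ((c * a) % d) (gcd∣[m*n]%d c a) L<v)) K+v<d

    sufficient : K + u < d → HasSumFreeInterval d (l + c) l (suc M)
    sufficient K+u<d with a , a<d , ca≡u ← gcd-multiple-residue c q =
      <⇒≤ (≤-<-trans 1+M≤K+u K+u<d) , a , a<d ,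
      Equivalence.from (sumFree⇔ l c M a) (subst (λ v → L < v × K + v < d) (sym v≡u) (L<u , K+u<d))
      where
      v≡u : (c * a) % d ≡ u
      v≡u = trans ca≡u (m<n⇒m%n≡m (≤-<-trans (m≤n+m u K) K+u<d))
      1+M≤K+u : suc M ≤ K + u
      1+M≤K+u = subst (_≤ K + u) (+-comm M 1) (+-mono-≤ (m≤n*m M (l + c)) (≤-<-trans z≤n L<u))

lemma10 : (k l d : ℕ) .{{_ : NonZero d}} → k > 0 → l > 0 → k > l → (m : ℕ) → m > 0 →
    (HasSumFreeInterval d k l m
    ⇔ k * (m ∸ 1) + ceilDiv (l * (m ∸ 1) + 1) (gcd d (k ∸ l)) * gcd d (k ∸ l) < d)
lemma10 k l d k>0 _ k>l (suc M) _ with c , refl ← m≤n⇒∃[o]m+o≡n (<⇒≤ k>l) rewrite m+n∸m≡n l c =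
  hasSumFreeInterval⇔ d l c M k>0
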